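{- For all formulas $\alpha,\beta$ built from variables by $\cdot,\backslash,\wedge,\vee,\neg$: if $\vdash_{\mathsf{G}}\alpha\Rightarrow\beta$, then $\vdash_{\mathsf{G_c}}\alpha\Rightarrow\beta$.
   Context: The calculus $\mathsf{G}$: formulas are built from variables by $\alpha\cdot\beta$, $\alpha\backslash\beta$, $\alpha\wedge\beta$, $\alpha\vee\beta$, $\neg\alpha$; sequents $\alpha\Rightarrow\beta$; axioms $(\mathrm{Id})\ \alpha\Rightarrow\alpha$, $(\mathrm{DN2})\ \neg\neg\alpha\Rightarrow\alpha$; rules (premises / conclusion): $(\mathrm{RES}\backslash)$ $\alpha\cdot\beta\Rightarrow\gamma$ / $\beta\Rightarrow\alpha\backslash\gamma$; $(\mathrm{RES}^-\backslash)$ $\beta\Rightarrow\alpha\backslash\gamma$ / $\alpha\cdot\beta\Rightarrow\gamma$; $(\wedge\mathrm{L})$ $\alpha\Rightarrow\beta$ / $\alpha\wedge\gamma\Rightarrow\beta$ and $\alpha\Rightarrow\beta$ / $\gamma\wedge\alpha\Rightarrow\beta$; $(\wedge\mathrm{R})$ $\alpha\Rightarrow\beta$, $\alpha\Rightarrow\gamma$ / $\alpha\Rightarrow\beta\wedge\gamma$; $(\vee\mathrm{L})$ $\alpha\Rightarrow\beta$, $\gamma\Rightarrow\beta$ / $\alpha\vee\gamma\Rightarrow\beta$; $(\vee\mathrm{R})$ $\alpha\Rightarrow\beta$ / $\alpha\Rightarrow\beta\vee\gamma$ and $\alpha\Rightarrow\beta$ / $\alpha\Rightarrow\gamma\vee\beta$;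 $(\neg)$ $\alpha\cdot\beta\Rightarrow\neg\gamma$ / $\gamma\cdot\beta\Rightarrow\neg\alpha$ and its special case $(\mathrm{MN})$ $\alpha\Rightarrow\neg\gamma$ / $\gamma\Rightarrow\neg\alpha$; $(\mathrm{Cut})$ $\alpha\Rightarrow\beta$, $\beta\Rightarrow\gamma$ / $\alpha\Rightarrow\gamma$. The Kolmogorov translation $ko$: $ko(p)=\neg\neg p$ for variables; $ko(\alpha\wedge\beta)=\neg\neg(ko(\alpha)\wedge ko(\beta))$; $ko(\alpha\vee\beta)=\neg\neg(ko(\alpha)\vee ko(\beta))$; $ko(\neg\alpha)=\neg ko(\alpha)$; $ko(\alpha\cdot\beta)=\neg\neg(ko(\alpha)\cdot ko(\beta))$; $ko(\alpha\backslash\beta)=\neg\neg(ko(\alpha)\backslash ko(\beta))$. The calculus $\mathsf{G_c}$: formulas are variables, the constant $\bot$, and $\alpha\cdot\beta$, $\alpha\backslash\beta$, $\alpha\wedge\beta$, $\alpha\vee\beta$, $\neg\alpha$ (with $\neg$ primitive). Formula structures: every formula is a structure, and if $\Gamma,\Delta$ are structures so are $(\Gamma,\Delta)$ and $(\Gamma;\Delta)$; a context $\Gamma[-]$ is a structure with one hole, $\Gamma[\Delta]$ the result of filling it; sequents are $\Gamma\Rightarrow\alpha$. $\mathsf{G_c}$ has NO cut rule; its rules are: $(\mathrm{Id})$ $\alpha\Rightarrow\alpha$; $(\cdot\mathrm{L})$ $\Gamma[\alpha,\beta]\Rightarrow\gamma$ / $\Gamma[\alpha\cdot\beta]\Rightarrow\gamma$;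 $(\cdot\mathrm{R})$ $\Gamma_1\Rightarrow\alpha$, $\Gamma_2\Rightarrow\beta$ / $\Gamma_1,\Gamma_2\Rightarrow\alpha\cdot\beta$; $(\backslash\mathrm{L})$ $\Delta\Rightarrow\alpha$, $\Gamma[\beta]\Rightarrow\gamma$ / $\Gamma[\Delta,\alpha\backslash\beta]\Rightarrow\gamma$; $(\backslash\mathrm{R})$ $\alpha,\Gamma\Rightarrow\beta$ / $\Gamma\Rightarrow\alpha\backslash\beta$; $(\neg\mathrm{L})$ $\Delta\Rightarrow\alpha$ / $\Delta;\neg\alpha\Rightarrow\bot$; $(\neg\mathrm{R})$ $\alpha;\Gamma\Rightarrow\bot$ / $\Gamma\Rightarrow\neg\alpha$; $(\wedge\mathrm{L})$ $\Gamma[\alpha]\Rightarrow\beta$ / $\Gamma[\alpha\wedge\gamma]\Rightarrow\beta$ and $\Gamma[\alpha]\Rightarrow\beta$ / $\Gamma[\gamma\wedge\alpha]\Rightarrow\beta$; $(\wedge\mathrm{R})$ $\Gamma\Rightarrow\alpha$, $\Gamma\Rightarrow\beta$ / $\Gamma\Rightarrow\alpha\wedge\beta$; $(\vee\mathrm{L})$ $\Gamma[\alpha]\Rightarrow\gamma$, $\Gamma[\beta]\Rightarrow\gamma$ / $\Gamma[\alpha\vee\beta]\Rightarrow\gamma$; $(\vee\mathrm{R})$ $\Gamma\Rightarrow\alpha$ / $\Gamma\Rightarrow\alpha\vee\beta$ and $\Gamma\Rightarrow\alpha$ / $\Gamma\Rightarrow\beta\vee\alpha$; $(\bot)$ $\Delta\Rightarrow\bot$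 / $\Gamma[\Delta]\Rightarrow\alpha$; $(\mathrm{R}\text{ - }\bot)$ $(\Delta_1,\Delta_2);\Delta_3\Rightarrow\bot$ / $(\Delta_1,\Delta_3);\Delta_2\Rightarrow\bot$; $(\mathrm{Ex})$ $\Gamma[\Delta_1,\Delta_2]\Rightarrow\beta$ / $\Gamma[\Delta_2,\Delta_1]\Rightarrow\beta$; $(\mathrm{Ex}^;)$ $\Gamma[\Delta_1;\Delta_2]\Rightarrow\beta$ / $\Gamma[\Delta_2;\Delta_1]\Rightarrow\beta$; $(\mathrm{As}_1)$ $\Gamma[\Delta_1,(\Delta_2,\Delta_3)]\Rightarrow\beta$ / $\Gamma[(\Delta_1,\Delta_2),\Delta_3]\Rightarrow\beta$; $(\mathrm{As}_2)$ the converse of $(\mathrm{As}_1)$; $(\mathrm{koL})$ $\Gamma[ko(\alpha)]\Rightarrow\beta$ / $\Gamma[\alpha]\Rightarrow\beta$; $(\mathrm{koR})$ $\Gamma\Rightarrow ko(\alpha)$ / $\Gamma\Rightarrow\alpha$. -}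

module Defs where

open import Data.Nat using (ℕ)

infixr 30 _·_
infixr 25 _\\_
infixr 20 _∧_
infixr 20 _∨_

data Fm : Set where
  var : ℕ → Fm
  _·_ _\\_ _∧_ _∨_ : Fm → Fm → Fm
  ¬_ : Fm → Fm

data G⊢_⇒_ : Fm → Fm → Set where
  Id    : ∀ {α} → G⊢ α ⇒ α
  DN2   : ∀ {α} → G⊢ ¬ ¬ α ⇒ α
  RES\\  : ∀ {α β γ} → G⊢ α · β ⇒ γ → G⊢ β ⇒ α \\ γ
  RES⁻\\ : ∀ {α β γ} → G⊢ β ⇒ α \\ γ → G⊢ α · β ⇒ γ
  ∧L₁   : ∀ {α β γ} → G⊢ α ⇒ β → G⊢ α ∧ γ ⇒ β
  ∧L₂   : ∀ {α β γ} → G⊢ α ⇒ β → G⊢ γ ∧ α ⇒ β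
  ∧R    : ∀ {α β γ} → G⊢ α ⇒ β → G⊢ α ⇒ γ → G⊢ α ⇒ β ∧ γ
  ∨L    : ∀ {α β γ} → G⊢ α ⇒ β → G⊢ γ ⇒ β → G⊢ α ∨ γ ⇒ β
  ∨R₁   : ∀ {α β γ} → G⊢ α ⇒ β → G⊢ α ⇒ β ∨ γ
  ∨R₂   : ∀ {α β γ} → G⊢ α ⇒ β → G⊢ α ⇒ γ ∨ β
  Neg   : ∀ {α β γ} → G⊢ α · β ⇒ ¬ γ → G⊢ γ · β ⇒ ¬ α
  MN    : ∀ {α γ} → G⊢ α ⇒ ¬ γ → G⊢ γ ⇒ ¬ α
  Cut   : ∀ {α β γ} → G⊢ α ⇒ β → G⊢ β ⇒ γ → G⊢ α ⇒ γ

data FmC : Set where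
  var : ℕ → FmC
  ⊥c : FmC
  _·_ _\\_ _∧_ _∨_ : FmC → FmC → FmC
  ¬_ : FmC → FmC

emb : Fm → FmC
emb (var p) = var p
emb (α · β) = emb α · emb β
emb (α \\ β) = emb α \\ emb β
emb (α ∧ β) = emb α ∧ emb β
emb (α ∨ β) = emb α ∨ emb β
emb (¬ α) = ¬ emb α

ko : Fm → FmC
ko (var p) = ¬ ¬ var p
ko (α ∧ β) = ¬ ¬ (ko α ∧ ko β)
ko (α ∨ β) = ¬ ¬ (ko α ∨ ko β)
ko (¬ α) = ¬ ko α
ko (α · β) = ¬ ¬ (ko α · ko β)
ko (α \\ β) = ¬ ¬ (ko α \\ ko β)

data Str : Set where
  fm   : FmC → Str
  _,,_ : Str → Str → Str
  _；_  : Str → Str → Str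

data Ctx : Set where
  hole : Ctx
  _,ₗ_ : Ctx → Str → Ctx
  _,ᵣ_ : Str → Ctx → Ctx
  _；ₗ_ : Ctx → Str → Ctx
  _；ᵣ_ : Str → Ctx → Ctx

_[_] : Ctx → Str → Str
hole [ Δ ] = Δ
(Γ ,ₗ Σ) [ Δ ] = (Γ [ Δ ]) ,, Σ
(Σ ,ᵣ Γ) [ Δ ] = Σ ,, (Γ [ Δ ])
(Γ ；ₗ Σ) [ Δ ] = (Γ [ Δ ]) ； Σ
(Σ ；ᵣ Γ) [ Δ ] = Σ ； (Γ [ Δ ])

data Gc⊢_⇒_ : Str → FmC → Set where
  Id   : ∀ {α} → Gc⊢ fm α ⇒ α
  ·L   : ∀ {Γ α β γ} → Gc⊢ Γ [ fm α ,, fm β ] ⇒ γ → Gc⊢ Γ [ fm (α · β) ] ⇒ γ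
  ·R   : ∀ {Γ₁ Γ₂ α β} → Gc⊢ Γ₁ ⇒ α → Gc⊢ Γ₂ ⇒ β → Gc⊢ Γ₁ ,, Γ₂ ⇒ α · β
  \\L   : ∀ {Γ Δ α β γ} → Gc⊢ Δ ⇒ α → Gc⊢ Γ [ fm β ] ⇒ γ
          → Gc⊢ Γ [ Δ ,, fm (α \\ β) ] ⇒ γ
  \\R   : ∀ {Γ α β} → Gc⊢ fm α ,, Γ ⇒ β → Gc⊢ Γ ⇒ α \\ β
  ¬L   : ∀ {Δ α} → Gc⊢ Δ ⇒ α → Gc⊢ Δ ； fm (¬ α) ⇒ ⊥c
  ¬R   : ∀ {Γ α} → Gc⊢ fm α ； Γ ⇒ ⊥c → Gc⊢ Γ ⇒ ¬ α
  ∧L₁  : ∀ {Γ α β γ} → Gc⊢ Γ [ fm α ] ⇒ β → Gc⊢ Γ [ fm (α ∧ γ) ] ⇒ β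
  ∧L₂  : ∀ {Γ α β γ} → Gc⊢ Γ [ fm α ] ⇒ β → Gc⊢ Γ [ fm (γ ∧ α) ] ⇒ β
  ∧R   : ∀ {Γ α β} → Gc⊢ Γ ⇒ α → Gc⊢ Γ ⇒ β → Gc⊢ Γ ⇒ α ∧ β
  ∨L   : ∀ {Γ α β γ} → Gc⊢ Γ [ fm α ] ⇒ γ → Gc⊢ Γ [ fm β ] ⇒ γ
          → Gc⊢ Γ [ fm (α ∨ β) ] ⇒ γ
  ∨R₁  : ∀ {Γ α β} → Gc⊢ Γ ⇒ α → Gc⊢ Γ ⇒ α ∨ β
  ∨R₂  : ∀ {Γ α β} → Gc⊢ Γ ⇒ α → Gc⊢ Γ ⇒ β ∨ α
  ⊥R   : ∀ {Γ Δ α} → Gc⊢ Δ ⇒ ⊥c → Gc⊢ Γ [ Δ ] ⇒ α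
  R-⊥  : ∀ {Δ₁ Δ₂ Δ₃} → Gc⊢ (Δ₁ ,, Δ₂) ； Δ₃ ⇒ ⊥c → Gc⊢ (Δ₁ ,, Δ₃) ； Δ₂ ⇒ ⊥c
  Ex   : ∀ {Γ Δ₁ Δ₂ β} → Gc⊢ Γ [ Δ₁ ,, Δ₂ ] ⇒ β → Gc⊢ Γ [ Δ₂ ,, Δ₁ ] ⇒ β
  Ex；  : ∀ {Γ Δ₁ Δ₂ β} → Gc⊢ Γ [ Δ₁ ； Δ₂ ] ⇒ β → Gc⊢ Γ [ Δ₂ ； Δ₁ ] ⇒ β
  As₁  : ∀ {Γ Δ₁ Δ₂ Δ₃ β} → Gc⊢ Γ [ Δ₁ ,, (Δ₂ ,, Δ₃) ] ⇒ β
          → Gc⊢ Γ [ (Δ₁ ,, Δ₂) ,, Δ₃ ] ⇒ β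
  As₂  : ∀ {Γ Δ₁ Δ₂ Δ₃ β} → Gc⊢ Γ [ (Δ₁ ,, Δ₂) ,, Δ₃ ] ⇒ β
          → Gc⊢ Γ [ Δ₁ ,, (Δ₂ ,, Δ₃) ] ⇒ β
  koL  : ∀ {Γ α β} → Gc⊢ Γ [ fm (ko α) ] ⇒ β → Gc⊢ Γ [ fm (emb α) ] ⇒ β
  koR  : ∀ {Γ α} → Gc⊢ Γ ⇒ ko α → Gc⊢ Γ ⇒ emb α

{-# OPTIONS --safe #-}
module Submission where

open import Defs
open import Data.Product using (Σ-syntax; _×_; _,_; proj₁; proj₂)
open import Data.Sum using (_⊎_; inj₁; inj₂)
open import Relation.Binary.PropositionalEquality using (_≡_; refl)

-- Interpret each formula as a set of structures, closed under double orthogonality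
-- for the relation "Γ ； Δ ⇒ ⊥c is derivable in G_c".  Every rule of G is sound for
-- this interpretation (DN2 because interpretations are closed).  Each ⟦ α ⟧ contains
-- ko α, and every member of ⟦ α ⟧ derives ko α; so a G-derivation of α ⇒ β yields
-- ko α ⇒ ko β, whence emb α ⇒ emb β by koL and koR.

Phase : Set₁
Phase = Str → Set

infixl 40 _ᗮ

_ᗮ : Phase → Phase
(S ᗮ) Γ = ∀ Δ → S Δ → Gc⊢ Γ ； Δ ⇒ ⊥c

Closed : Phase → Set
Closed S = ∀ Γ → (S ᗮ ᗮ) Γ → S Γ

⊥-swap : ∀ {Γ Δ} → Gc⊢ Γ ； Δ ⇒ ⊥c → Gc⊢ Δ ； Γ ⇒ ⊥c
⊥-swap = Ex； {Γ = hole}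

ᗮᗮ-unit : ∀ {S : Phase} {Γ} → S Γ → (S ᗮ ᗮ) Γ
ᗮᗮ-unit {Γ = Γ} s Δ h = ⊥-swap (h Γ s)

ᗮ-antitone : ∀ {S T : Phase} → (∀ Γ → S Γ → T Γ) → ∀ Γ → (T ᗮ) Γ → (S ᗮ) Γ
ᗮ-antitone f Γ h Δ s = h Δ (f Δ s)

ᗮ-closed : ∀ (S : Phase) → Closed (S ᗮ)
ᗮ-closed S Γ h Δ s = h Δ (ᗮᗮ-unit s)

ᗮᗮ-elim : ∀ {S T : Phase} → Closed T → (∀ Γ → S Γ → T Γ) → ∀ Γ → (S ᗮ ᗮ) Γ → T Γ
ᗮᗮ-elim T-closed f Γ h = T-closed Γ (ᗮ-antitone (ᗮ-antitone f) Γ h)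

×-closed : ∀ {S T : Phase} → Closed S → Closed T → Closed (λ Γ → S Γ × T Γ)
×-closed S-closed T-closed Γ h =
  ᗮᗮ-elim S-closed (λ _ → proj₁) Γ h , ᗮᗮ-elim T-closed (λ _ → proj₂) Γ h

_⊸_ : Phase → Phase → Phase
(S ⊸ T) Δ = ∀ Γ → S Γ → T (Γ ,, Δ)

-- R-⊥ moves Γ across the semicolon, which is what lets closure commute with ⊸.
⊸-closed : ∀ (S : Phase) {T : Phase} → Closed T → Closed (S ⊸ T)
⊸-closed S T-closed Δ h Γ s = T-closed (Γ ,, Δ) λ Σ t →
  R-⊥ (⊥-swap (h (Γ ,, Σ) (λ Δ′ f → R-⊥ (⊥-swap (t (Γ ,, Δ′) (f Γ s))))))

_⊗_ : Phase → Phase → Phase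
(S ⊗ T) Δ = Σ[ Γ₁ ∈ Str ] Σ[ Γ₂ ∈ Str ] (Δ ≡ (Γ₁ ,, Γ₂)) × S Γ₁ × T Γ₂

⊗-intro : ∀ {S T : Phase} {Γ₁ Γ₂} → S Γ₁ → T Γ₂ → (S ⊗ T) (Γ₁ ,, Γ₂)
⊗-intro s t = _ , _ , refl , s , t

¬¬-intro : ∀ {Γ α} → Gc⊢ Γ ⇒ α → Gc⊢ Γ ⇒ ¬ ¬ α
¬¬-intro p = ¬R (⊥-swap (¬L p))

ᗮᗮ⇒¬¬ : ∀ {S : Phase} {α Γ} → (∀ Δ → S Δ → Gc⊢ Δ ⇒ α) → (S ᗮ ᗮ) Γ → Gc⊢ Γ ⇒ ¬ ¬ α
ᗮᗮ⇒¬¬ {α = α} f h = ¬R (⊥-swap (h (fm (¬ α)) (λ Δ s → ⊥-swap (¬L (f Δ s)))))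

¬¬-closed : ∀ {S : Phase} {α} → Closed S → S (fm α) → S (fm (¬ ¬ α))
¬¬-closed {α = α} S-closed s =
  S-closed _ λ Δ h → ⊥-swap (¬L (¬R (⊥-swap (h (fm α) s))))

⟦_⟧ : Fm → Phase
⟦ var p ⟧ = (λ Δ → Δ ≡ fm (¬ var p)) ᗮ
⟦ ¬ α ⟧ = ⟦ α ⟧ ᗮ
⟦ α ∧ β ⟧ = λ Γ → ⟦ α ⟧ Γ × ⟦ β ⟧ Γ
⟦ α ∨ β ⟧ = (λ Γ → ⟦ α ⟧ Γ ⊎ ⟦ β ⟧ Γ) ᗮ ᗮ
⟦ α · β ⟧ = (⟦ α ⟧ ⊗ ⟦ β ⟧) ᗮ ᗮ
⟦ α \\ β ⟧ = ⟦ α ⟧ ⊸ ⟦ β ⟧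

⟦⟧-closed : ∀ α → Closed ⟦ α ⟧
⟦⟧-closed (var p) = ᗮ-closed _
⟦⟧-closed (¬ α) = ᗮ-closed _
⟦⟧-closed (α ∨ β) = ᗮ-closed _
⟦⟧-closed (α · β) = ᗮ-closed _
⟦⟧-closed (α ∧ β) = ×-closed (⟦⟧-closed α) (⟦⟧-closed β)
⟦⟧-closed (α \\ β) = ⊸-closed ⟦ α ⟧ (⟦⟧-closed β)

mutual
  ⟦⟧⇒ko : ∀ α Γ → ⟦ α ⟧ Γ → Gc⊢ Γ ⇒ ko α
  ⟦⟧⇒ko (var p) Γ h = ¬R (⊥-swap (h _ refl))
  ⟦⟧⇒ko (¬ α) Γ h = ¬R (⊥-swap (h _ (ko∈⟦⟧ α)))
  ⟦⟧⇒ko (α ∧ β) Γ (a , b) = ¬¬-intro (∧R (⟦⟧⇒ko α Γ a) (⟦⟧⇒ko β Γ b))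
  ⟦⟧⇒ko (α ∨ β) Γ = ᗮᗮ⇒¬¬ λ where
    Δ (inj₁ a) → ∨R₁ (⟦⟧⇒ko α Δ a)
    Δ (inj₂ b) → ∨R₂ (⟦⟧⇒ko β Δ b)
  ⟦⟧⇒ko (α · β) Γ = ᗮᗮ⇒¬¬ λ where
    _ (Γ₁ , Γ₂ , refl , a , b) → ·R (⟦⟧⇒ko α Γ₁ a) (⟦⟧⇒ko β Γ₂ b)
  ⟦⟧⇒ko (α \\ β) Γ h = ¬¬-intro (\\R (⟦⟧⇒ko β _ (h (fm (ko α)) (ko∈⟦⟧ α))))

  ko∈⟦⟧ : ∀ α → ⟦ α ⟧ (fm (ko α))
  ko∈⟦⟧ (var p) Δ refl = ⊥-swap (¬L Id)
  ko∈⟦⟧ (¬ α) Δ a = ⊥-swap (¬L (⟦⟧⇒ko α Δ a))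
  ko∈⟦⟧ (α ∧ β) = ¬¬-closed (⟦⟧-closed (α ∧ β))
    ( ⟦⟧-closed α _ (λ Δ h → ⊥-swap (∧L₁ {Γ = Δ ；ᵣ hole} (h _ (ko∈⟦⟧ α))))
    , ⟦⟧-closed β _ (λ Δ h → ⊥-swap (∧L₂ {Γ = Δ ；ᵣ hole} (h _ (ko∈⟦⟧ β)))))
  ko∈⟦⟧ (α ∨ β) = ¬¬-closed (⟦⟧-closed (α ∨ β)) λ Δ h →
    ⊥-swap (∨L {Γ = Δ ；ᵣ hole} (h _ (inj₁ (ko∈⟦⟧ α))) (h _ (inj₂ (ko∈⟦⟧ β))))
  ko∈⟦⟧ (α · β) = ¬¬-closed (⟦⟧-closed (α · β)) λ Δ h →
    ⊥-swap (·L {Γ = Δ ；ᵣ hole} (h _ (⊗-intro (ko∈⟦⟧ α) (ko∈⟦⟧ β))))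
  ko∈⟦⟧ (α \\ β) = ¬¬-closed (⟦⟧-closed (α \\ β)) λ Γ a → ⟦⟧-closed β _ λ Σ h →
    \\L {Γ = hole ；ₗ Σ} (⟦⟧⇒ko α Γ a) (⊥-swap (h _ (ko∈⟦⟧ β)))

⟦⟧-sound : ∀ {α β} → G⊢ α ⇒ β → ∀ Γ → ⟦ α ⟧ Γ → ⟦ β ⟧ Γ
⟦⟧-sound Id Γ a = a
⟦⟧-sound (DN2 {α}) = ⟦⟧-closed α
⟦⟧-sound (Cut p q) Γ a = ⟦⟧-sound q Γ (⟦⟧-sound p Γ a)
⟦⟧-sound (RES\\ p) Δ b Γ a = ⟦⟧-sound p (Γ ,, Δ) (ᗮᗮ-unit (⊗-intro a b))
⟦⟧-sound (RES⁻\\ {γ = γ} p) = ᗮᗮ-elim (⟦⟧-closed γ) λ where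
  _ (Γ₁ , Γ₂ , refl , a , b) → ⟦⟧-sound p Γ₂ b Γ₁ a
⟦⟧-sound (∧L₁ p) Γ (a , _) = ⟦⟧-sound p Γ a
⟦⟧-sound (∧L₂ p) Γ (_ , a) = ⟦⟧-sound p Γ a
⟦⟧-sound (∧R p q) Γ a = ⟦⟧-sound p Γ a , ⟦⟧-sound q Γ a
⟦⟧-sound (∨L {β = β} p q) = ᗮᗮ-elim (⟦⟧-closed β) λ where
  Δ (inj₁ a) → ⟦⟧-sound p Δ a
  Δ (inj₂ c) → ⟦⟧-sound q Δ c
⟦⟧-sound (∨R₁ p) Γ a = ᗮᗮ-unit (inj₁ (⟦⟧-sound p Γ a))
⟦⟧-sound (∨R₂ p) Γ a = ᗮᗮ-unit (inj₂ (⟦⟧-sound p Γ a))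
⟦⟧-sound (MN p) Γ c Δ a = ⊥-swap (⟦⟧-sound p Δ a Γ c)
⟦⟧-sound (Neg {α} p) = ᗮᗮ-elim (⟦⟧-closed (¬ α)) λ where
  _ (Σ , Δ , refl , c , b) Γ a →
    Ex {Γ = hole ；ₗ Γ} (R-⊥ (Ex {Γ = hole ；ₗ Σ}
      (⟦⟧-sound p (Γ ,, Δ) (ᗮᗮ-unit (⊗-intro a b)) Σ c)))

theorem9 : ∀ (α β : Fm) → G⊢ α ⇒ β → Gc⊢ fm (emb α) ⇒ emb β
theorem9 α β d =
  koL {Γ = hole} {α = α} (koR {α = β} (⟦⟧⇒ko β _ (⟦⟧-sound d _ (ko∈⟦⟧ α))))
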